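{- Let $T$ be a tree of arbitrary degree and $T'$ its ternarization. For vertices $u,v,r$ of $T$, the owner of $LCA_{T'}(u,v,r)$ equals $LCA_T(u,v,r)$.
   Context: The ternarization $T'$ of $T$ is a tree of maximum degree 3 obtained by replacing each vertex $v$ of $T$ by a chain (path) consisting of $v$ itself and dummy vertices whose owner is $v$ (the owner of $v$ itself is $v$), consecutive chain vertices joined by edges, and replacing each edge $(v,w)$ of $T$ by an edge between a vertex of the chain of $v$ and a vertex of the chain of $w$ (each chain vertex attached to at most one such original edge). For an unrooted tree and vertices $a,b,r$, $a$ is an ancestor of $b$ with respect to root $r$ if $a$ lies on the unique path from $b$ to $r$ (a vertex is its own ancestor); $LCA(u,v,r)$ is the vertex $c$ that is a common ancestor of $u$ and $v$ with respect to $r$ such that every common ancestor of $u$ and $v$ is an ancestor of $c$ (equivalently, the unique vertex minimizing the sum of unweighted distances to $u$, $v$ and $r$). -}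

module Defs where

open import Data.Nat using (ℕ)
open import Data.Fin using (Fin)
open import Data.List using (List; []; _∷_; _++_)
open import Data.List.Membership.Propositional using (_∈_)
open import Data.List.Relation.Unary.Unique.Propositional using (Unique)
open import Data.Product using (Σ; ∃; _×_; _,_)
open import Data.Sum using (_⊎_)
open import Relation.Binary.PropositionalEquality using (_≡_; _≢_)
open import Relation.Nullary using (¬_)
open import Function.Bundles using (_⇔_)

Adjacency : ℕ → Set₁
Adjacency n = Fin n → Fin n → Set

data Walk {n : ℕ} (E : Adjacency n) : Fin n → Fin n → List (Fin n) → Set where
  here : ∀ a → Walk E a a (a ∷ [])
  step : ∀ {a b c xs} → E a b → Walk E b c xs → Walk E a c (a ∷ xs)

IsPath : ∀ {n} → Adjacency n → Fin n → Fin n → List (Fin n) → Set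
IsPath E a b xs = Walk E a b xs × Unique xs

record IsTree {n : ℕ} (E : Adjacency n) : Set where
  field
    sym     : ∀ {a b} → E a b → E b a
    irrefl  : ∀ {a} → ¬ E a a
    path∃   : ∀ a b → ∃ λ xs → IsPath E a b xs
    path!   : ∀ {a b xs ys} → IsPath E a b xs → IsPath E a b ys → xs ≡ ys

Ancestor : ∀ {n} → Adjacency n → (a b r : Fin n) → Set
Ancestor E a b r = ∃ λ xs → IsPath E b r xs × a ∈ xs

IsLCA : ∀ {n} → Adjacency n → (u v r c : Fin n) → Set
IsLCA E u v r c =
  (Ancestor E c u r × Ancestor E c v r) ×
  (∀ d → Ancestor E d u r → Ancestor E d v r → Ancestor E d c r)

Consecutive : ∀ {A : Set} → List A → A → A → Set
Consecutive {A} L x y = ∃ λ (pre : List A) → ∃ λ (post : List A) → L ≡ pre ++ (x ∷ y ∷ post)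

-- T' (on Fin m, adjacency E') is a ternarization of T (on Fin n, adjacency E).
-- owner x : the vertex of T whose chain contains x;  orig v : the vertex v itself in T'.
record IsTernarization {n m : ℕ} (E : Adjacency n) (E' : Adjacency m)
                       (owner : Fin m → Fin n) (orig : Fin n → Fin m) : Set where
  field
    sym'          : ∀ {x y} → E' x y → E' y x
    irrefl'       : ∀ {x} → ¬ E' x x
    owner-orig    : ∀ v → owner (orig v) ≡ v
    -- the chain of v: a list (path order) of exactly the vertices owned by v
    chain         : Fin n → List (Fin m)
    chain-unique  : ∀ v → Unique (chain v)
    chain-mem     : ∀ v x → (x ∈ chain v) ⇔ (owner x ≡ v)
    chain-edges   : ∀ x y → owner x ≡ owner y →
                    E' x y ⇔ (Consecutive (chain (owner x)) x y ⊎ Consecutive (chain (owner x)) y x)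
    cross-sound   : ∀ x y → owner x ≢ owner y → E' x y → E (owner x) (owner y)
    -- each edge (v,w) of T is replaced by exactly one edge between the chains
    cross-exists  : ∀ v w → E v w → ∃ λ x → ∃ λ y → owner x ≡ v × owner y ≡ w × E' x y
    cross-unique  : ∀ x y x' y' → owner x ≡ owner x' → owner y ≡ owner y' →
                    owner x ≢ owner y → E' x y → E' x' y' → x ≡ x' × y ≡ y'
    cross-atmost1 : ∀ x y z → owner y ≢ owner x → owner z ≢ owner x →
                    E' x y → E' x z → y ≡ z
    -- (consequence of the construction, recorded for convenience) T' is a tree
    tree'         : IsTree E'

module Submission where

-- Projecting a walk of T′ along the owner map gives a walk of T through the owners, and since chains
-- are connected, a walk of T lifts to a walk of T′ through the chains of its vertices.  In a tree the
-- path lies inside every walk, so the owners of the T′-path between orig a and orig b form exactly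
-- the T-path between a and b; hence owner c′ is a common ancestor of u and v.  A common ancestor d
-- of u and v owns a vertex on each T′-branch from orig u and orig v to orig r.  If one of them lies
-- at or above c′, then d is an ancestor of owner c′.  Otherwise the chain of d joins the two branches
-- below c′; every walk from orig u to orig v passes through their LCA c′, so c′ is in that chain,
-- i.e. owner c′ = d.

open import Defs
open import Data.Nat using (ℕ)
open import Data.Fin using (Fin; _≟_)
open import Data.Empty using (⊥-elim)
open import Data.List using (List; []; _∷_; _++_; [_]; map; reverse)
open import Data.List.Properties using (++-assoc; reverse-++; unfold-reverse)
open import Data.List.Membership.Propositional using (_∈_)
import Data.List.Membership.DecPropositional as DecMembership
open import Data.List.Membership.Propositional.Properties using (∈-++⁻; ∈-++⁺ˡ; ∈-++⁺ʳ; ∈-∃++; ∈-map⁺; ∈-map⁻)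
open import Data.List.Relation.Unary.Any using (here; there)
open import Data.List.Relation.Unary.Any.Properties using (reverse⁻)
open import Data.List.Relation.Unary.All as All using (All; []; _∷_)
import Data.List.Relation.Unary.All.Properties as All
open import Data.List.Relation.Unary.Linked using (Linked; []; [-]; _∷_)
open import Data.List.Relation.Unary.Unique.Propositional using (Unique; []; _∷_)
open import Data.List.Relation.Unary.Unique.Propositional.Properties using (++⁺)
open import Data.List.Relation.Binary.Disjoint.Propositional using (Disjoint)
import Data.List.Relation.Binary.Permutation.Setoid as ↭
import Data.List.Relation.Binary.Permutation.Setoid.Properties as ↭
open import Data.Product using (∃; ∃₂; _×_; _,_; proj₁; proj₂)
open import Data.Sum using (_⊎_; inj₁; inj₂; fromInj₂)
open import Function.Bundles using (_⇔_; mk⇔; Equivalence)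
open import Relation.Binary.PropositionalEquality using (_≡_; _≢_; refl; sym; trans; subst; cong; setoid)
open import Relation.Nullary using (yes; no)

private variable
  A : Set
  x y : A
  xs ys : List A
  n : ℕ
  E : Adjacency n
  P Q : Fin n → Set
  a b c u v r : Fin n
  ps : List (Fin n)

Unique-++⁻ˡ : ∀ xs → Unique (xs ++ ys) → Unique xs
Unique-++⁻ˡ []       _         = []
Unique-++⁻ˡ (x ∷ xs) (x∉ ∷ xs!) = All.++⁻ˡ xs x∉ ∷ Unique-++⁻ˡ xs xs!

Unique-++⁻ʳ : ∀ xs → Unique (xs ++ ys) → Unique ys
Unique-++⁻ʳ []       ys!       = ys!
Unique-++⁻ʳ (x ∷ xs) (_ ∷ xs!) = Unique-++⁻ʳ xs xs!

Unique-++⇒Disjoint : ∀ xs → Unique (xs ++ ys) → Disjoint xs ys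
Unique-++⇒Disjoint (x ∷ xs) (x∉ ∷ _)   (here refl , v∈) = All.lookup (All.++⁻ʳ xs x∉) v∈ refl
Unique-++⇒Disjoint (x ∷ xs) (_  ∷ xs!) (there v∈ , w∈) = Unique-++⇒Disjoint xs xs! (v∈ , w∈)

Unique-reverse⁺ : ∀ {A : Set} {xs : List A} → Unique xs → Unique (reverse xs)
Unique-reverse⁺ {A} {xs} =
  ↭.Unique-resp-↭ (setoid A) (↭.↭-sym (setoid A) (↭.↭-reverse (setoid A) xs))

Consecutive⇒∈ : ∀ {L : List A} → Consecutive L x y → x ∈ L × y ∈ L
Consecutive⇒∈ (pre , _ , refl) = ∈-++⁺ʳ pre (here refl) , ∈-++⁺ʳ pre (there (here refl))

Consecutive⇒Linked : ∀ {R : A → A → Set} L → (∀ {x y} → Consecutive L x y → R x y) → Linked R L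
Consecutive⇒Linked []           _ = []
Consecutive⇒Linked (x ∷ [])     _ = [-]
Consecutive⇒Linked (x ∷ y ∷ L) R-cons =
  R-cons ([] , L , refl) ∷
  Consecutive⇒Linked (y ∷ L) λ (pre , post , eq) → R-cons (x ∷ pre , post , cong (x ∷_) eq)

walk-++ : Walk E a b xs → Walk E b c (b ∷ ys) → Walk E a c (xs ++ ys)
walk-++ (here _)   w′ = w′
walk-++ (step e w) w′ = step e (walk-++ w w′)

walk-split : ∀ xs → Walk E a b (xs ++ c ∷ ys) → Walk E a c (xs ++ [ c ]) × Walk E c b (c ∷ ys)
walk-split []            (here a)   = here a , here a
walk-split []            (step e w) = here _ , step e w
walk-split (x ∷ [])      (step e w) = let w₁ , w₂ = walk-split [] w in step e w₁ , w₂
walk-split (x ∷ x′ ∷ xs) (step e w) = let w₁ , w₂ = walk-split (x′ ∷ xs) w in step e w₁ , w₂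

walk-reverse : (∀ {a b} → E a b → E b a) → Walk E a b xs → Walk E b a (reverse xs)
walk-reverse E-sym (here a) = here a
walk-reverse E-sym (step {a = a} {xs = xs} e w) =
  subst (Walk _ _ _) (sym (unfold-reverse a xs)) (walk-++ (walk-reverse E-sym w) (step (E-sym e) (here a)))

path-split : ∀ xs → IsPath E a b (xs ++ c ∷ ys) → IsPath E a c (xs ++ [ c ]) × IsPath E c b (c ∷ ys)
path-split {c = c} {ys = ys} xs (w , xs!) =
  let w₁ , w₂ = walk-split xs w in
  (w₁ , Unique-++⁻ˡ (xs ++ [ c ]) (subst Unique (sym (++-assoc xs [ c ] ys)) xs!)) ,
  (w₂ , Unique-++⁻ʳ xs xs!)

path-reverse : (∀ {a b} → E a b → E b a) → IsPath E a b xs → IsPath E b a (reverse xs)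
path-reverse E-sym (w , xs!) = walk-reverse E-sym w , Unique-reverse⁺ xs!

path-join : ∀ xs → IsPath E a c (xs ++ [ c ]) → IsPath E c b (c ∷ ys) → Disjoint xs (c ∷ ys) →
            IsPath E a b (xs ++ c ∷ ys)
path-join {c = c} {ys = ys} xs (w₁ , xs!) (w₂ , ys!) xs#ys =
  subst (Walk _ _ _) (++-assoc xs [ c ] ys) (walk-++ w₁ w₂) , ++⁺ (Unique-++⁻ˡ xs xs!) ys! xs#ys

data WalkIn {n} (E : Adjacency n) (P : Fin n → Set) : Fin n → Fin n → Set where
  stop : ∀ {a} → P a → WalkIn E P a a
  move : ∀ {a b c} → P a → E a b → WalkIn E P b c → WalkIn E P a c

walkIn-source : WalkIn E P a b → P a
walkIn-source (stop p)     = p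
walkIn-source (move p _ _) = p

walkIn-map : (∀ {x} → P x → Q x) → WalkIn E P a b → WalkIn E Q a b
walkIn-map f (stop p)     = stop (f p)
walkIn-map f (move p e w) = move (f p) e (walkIn-map f w)

walkIn-++ : WalkIn E P a b → WalkIn E P b c → WalkIn E P a c
walkIn-++ (stop _)     w′ = w′
walkIn-++ (move p e w) w′ = move p e (walkIn-++ w w′)

walkIn-reverse : (∀ {a b} → E a b → E b a) → WalkIn E P a b → WalkIn E P b a
walkIn-reverse E-sym (stop p)     = stop p
walkIn-reverse E-sym (move p e w) =
  walkIn-++ (walkIn-reverse E-sym w) (move (walkIn-source w) (E-sym e) (stop p))

walk⇒walkIn : Walk E a b xs → All P xs → WalkIn E P a b
walk⇒walkIn (here _)   (p ∷ _)  = stop p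
walk⇒walkIn (step e w) (p ∷ ps) = move p e (walk⇒walkIn w ps)

Linked⇒walkIn : ∀ {L} → (∀ {a b} → E a b → E b a) → Linked E L → a ∈ L → b ∈ L → WalkIn E (_∈ L) a b
Linked⇒walkIn {L = []}    _     _      ()
Linked⇒walkIn {L = _ ∷ _} E-sym linked a∈ b∈ =
  walkIn-++ (walkIn-reverse E-sym (from-head linked a∈)) (from-head linked b∈)
  where
  from-head : ∀ {h L} → Linked E (h ∷ L) → a ∈ h ∷ L → WalkIn E (_∈ h ∷ L) h a
  from-head _            (here refl) = stop (here refl)
  from-head (e ∷ linked) (there a∈)  = move (here refl) e (walkIn-map there (from-head linked a∈))

walkIn⇒path : WalkIn E P a b → ∃ λ ps → IsPath E a b ps × All P ps
walkIn⇒path (stop {a} p) = [ a ] , (here a , [] ∷ []) , p ∷ []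
walkIn⇒path (move {a} p e w) with walkIn⇒path w
... | ps , (w′ , ps!) , Pps with DecMembership._∈?_ _≟_ a ps
...   | no a∉ =
  a ∷ ps , (step e w′ , All.tabulate (λ a′∈ a≡a′ → a∉ (subst (_∈ ps) (sym a≡a′) a′∈)) ∷ ps!) , p ∷ Pps
...   | yes a∈ with ∈-∃++ a∈
...     | pre , post , refl = a ∷ post , proj₂ (path-split pre (w′ , ps!)) , All.++⁻ʳ pre Pps

ancestor-split : Ancestor E c u r → ∃₂ λ p q → IsPath E u r (p ++ c ∷ q)
ancestor-split (zs , path , c∈) with ∈-∃++ c∈
... | p , q , refl = p , q , path

prefix-avoids : ∀ {x} xs → IsPath E a b (xs ++ c ∷ ys) → x ∈ xs → WalkIn E (_≢ c) a x
prefix-avoids {c = c} {ys = ys} {x = x} xs (w , xs!) x∈ with ∈-∃++ x∈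
... | pre , post , refl =
  walk⇒walkIn (proj₁ (walk-split pre (subst (Walk _ _ _) (++-assoc pre (x ∷ post) (c ∷ ys)) w)))
              (All.++⁺ (All.++⁻ˡ pre avoids) (All.head (All.++⁻ʳ pre avoids) ∷ []))
  where
  avoids : All (_≢ c) (pre ++ x ∷ post)
  avoids = All.tabulate λ z∈ z≡c → Unique-++⇒Disjoint (pre ++ x ∷ post) xs! (z∈ , here z≡c)

module _ (T : IsTree E) where
  open IsTree T renaming (sym to E-sym)

  path-within : IsPath E a b ps → WalkIn E P a b → All P ps
  path-within path w = let qs , path′ , Pqs = walkIn⇒path w in subst (All _) (path! path′ path) Pqs

  walkIn-through-lca : IsLCA E u v r c → WalkIn E P u v → P c
  walkIn-through-lca {u = u} {v = v} {c = c} ((cu , cv) , lowest) w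
    with ancestor-split cu | ancestor-split cv
  ... | p₁ , q₁ , path₁ | p₂ , q₂ , path₂ = All.lookup (path-within through-c w) (∈-++⁺ʳ p₁ (here refl))
    where
    c→v : IsPath E c v (c ∷ reverse p₂)
    c→v = subst (IsPath E c v) (reverse-++ p₂ [ c ]) (path-reverse E-sym (proj₁ (path-split p₂ path₂)))

    -- A vertex on both branches below c would be a common ancestor, hence lie above c.
    branches-disjoint : Disjoint p₁ (c ∷ reverse p₂)
    branches-disjoint (z∈p₁ , here refl) = Unique-++⇒Disjoint p₁ (proj₂ path₁) (z∈p₁ , here refl)
    branches-disjoint {z} (z∈p₁ , there z∈p₂) =
      let zs , c→r , z∈zs =
            lowest z (_ , path₁ , ∈-++⁺ˡ z∈p₁) (_ , path₂ , ∈-++⁺ˡ {xs = p₂} (reverse⁻ z∈p₂))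
      in Unique-++⇒Disjoint p₁ (proj₂ path₁)
           (z∈p₁ , subst (z ∈_) (path! c→r (proj₂ (path-split p₁ path₁))) z∈zs)

    through-c : IsPath E u v (p₁ ++ c ∷ reverse p₂)
    through-c = path-join p₁ (proj₁ (path-split p₁ path₁)) c→v branches-disjoint

  lca-on-branch-connector : ∀ p₁ p₂ {q₁ q₂ x y} → IsLCA E u v r c →
                     IsPath E u r (p₁ ++ c ∷ q₁) → IsPath E v r (p₂ ++ c ∷ q₂) →
                     x ∈ p₁ → y ∈ p₂ → WalkIn E Q x y → Q c
  lca-on-branch-connector {c = c} {Q = Q} p₁ p₂ lca path₁ path₂ x∈ y∈ w =
    fromInj₂ (λ c≢c → ⊥-elim (c≢c refl)) (walkIn-through-lca {P = λ z → z ≢ c ⊎ Q z} lca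
      (walkIn-++ (walkIn-map inj₁ (prefix-avoids p₁ path₁ x∈))
        (walkIn-++ (walkIn-map inj₂ w)
          (walkIn-map inj₁ (walkIn-reverse E-sym (prefix-avoids p₂ path₂ y∈))))))

module Ternarization {n m} {E : Adjacency n} {E′ : Adjacency m}
                     {owner : Fin m → Fin n} {orig : Fin n → Fin m}
                     (T : IsTree E) (T′ : IsTernarization E E′ owner orig) where
  open IsTernarization T′
  open Equivalence using (to; from)

  chain-linked : ∀ v → Linked E′ (chain v)
  chain-linked v = Consecutive⇒Linked (chain v) λ {x} {y} xy →
    let x∈ , y∈ = Consecutive⇒∈ xy
        ox = to (chain-mem v x) x∈
    in from (chain-edges x y (trans ox (sym (to (chain-mem v y) y∈))))
            (inj₁ (subst (λ w → Consecutive (chain w) x y) (sym ox) xy))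

  chain-walkIn : ∀ {x y} → owner x ≡ owner y → WalkIn E′ (λ z → owner z ≡ owner x) x y
  chain-walkIn {x} {y} ox≡oy =
    walkIn-map (to (chain-mem (owner x) _))
      (Linked⇒walkIn sym' (chain-linked (owner x))
        (from (chain-mem _ x) refl) (from (chain-mem _ y) (sym ox≡oy)))

  walkIn-lift : ∀ {p q ps x y} → Walk E p q ps → owner x ≡ p → owner y ≡ q →
                WalkIn E′ (λ z → owner z ∈ ps) x y
  walkIn-lift (here _) refl oy = walkIn-map here (chain-walkIn (sym oy))
  walkIn-lift (step {b = p′} e w) refl oy with cross-exists _ p′ e
  ... | x₁ , y₁ , ox₁ , oy₁ , e′ =
    walkIn-++ (walkIn-map here (chain-walkIn (sym ox₁)))
              (move (here ox₁) e′ (walkIn-map there (walkIn-lift w oy₁ oy)))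

  walkIn-project : ∀ {x y zs} → Walk E′ x y zs → WalkIn E (_∈ map owner zs) (owner x) (owner y)
  walkIn-project (here _) = stop (here refl)
  walkIn-project {y = y} {x ∷ zs} (step {b = x′} e w) with owner x ≟ owner x′
  ... | yes ox≡ox′ =
    subst (λ p → WalkIn E (_∈ map owner (x ∷ zs)) p (owner y)) (sym ox≡ox′)
          (walkIn-map there (walkIn-project w))
  ... | no  ox≢ox′ = move (here refl) (cross-sound x x′ ox≢ox′ e) (walkIn-map there (walkIn-project w))

  ∈path⇔∈owners : ∀ {x y zs p q ps} → IsPath E′ x y zs → IsPath E p q ps → owner x ≡ p → owner y ≡ q →
                  ∀ {d} → d ∈ ps ⇔ d ∈ map owner zs
  ∈path⇔∈owners path′ path refl refl = mk⇔
    (All.lookup (path-within T path (walkIn-project (proj₁ path′))))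
    (λ d∈ → let z , z∈ , d≡oz = ∈-map⁻ owner d∈ in
      subst (_∈ _) (sym d≡oz) (All.lookup (path-within tree' path′ (walkIn-lift (proj₁ path) refl refl)) z∈))

  ancestor-owner : ∀ {z x y a b} → Ancestor E′ z x y → owner x ≡ a → owner y ≡ b →
                   Ancestor E (owner z) a b
  ancestor-owner {a = a} {b} (zs , path′ , z∈) ox oy =
    let ps , path = IsTree.path∃ T a b in
    ps , path , from (∈path⇔∈owners path′ path ox oy) (∈-map⁺ owner z∈)

  owner-on-path-ancestor : ∀ {c′ r zs z d} → IsPath E′ c′ (orig r) zs → z ∈ zs → d ≡ owner z →
                           Ancestor E d (owner c′) r
  owner-on-path-ancestor {r = r} path z∈ refl = ancestor-owner (_ , path , z∈) refl (owner-orig r)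

  owner-lca-lowest : ∀ {u v r c′ d} → IsLCA E′ (orig u) (orig v) (orig r) c′ →
                     Ancestor E d u r → Ancestor E d v r → Ancestor E d (owner c′) r
  owner-lca-lowest {u} {v} {r} {c′} lca@((c′u , c′v) , _) (_ , u→r , d∈₁) (_ , v→r , d∈₂)
    with ancestor-split c′u | ancestor-split c′v
  ... | p₁ , q₁ , path₁ | p₂ , q₂ , path₂
    with ∈-map⁻ owner (to (∈path⇔∈owners path₁ u→r (owner-orig u) (owner-orig r)) d∈₁)
       | ∈-map⁻ owner (to (∈path⇔∈owners path₂ v→r (owner-orig v) (owner-orig r)) d∈₂)
  ... | x , x∈ , d≡ox | y , y∈ , d≡oy with ∈-++⁻ p₁ x∈ | ∈-++⁻ p₂ y∈
  ... | inj₂ x∈q₁ | _         = owner-on-path-ancestor (proj₂ (path-split p₁ path₁)) x∈q₁ d≡ox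
  ... | inj₁ _    | inj₂ y∈q₂ = owner-on-path-ancestor (proj₂ (path-split p₂ path₂)) y∈q₂ d≡oy
  ... | inj₁ x∈p₁ | inj₁ y∈p₂ =
    owner-on-path-ancestor (proj₂ (path-split p₁ path₁)) (here refl) (trans d≡ox (sym c′-in-chain))
    where
    c′-in-chain : owner c′ ≡ owner x
    c′-in-chain =
      lca-on-branch-connector tree' p₁ p₂ lca path₁ path₂ x∈p₁ y∈p₂ (chain-walkIn (trans (sym d≡ox) d≡oy))

theorem4p7 : ∀ {n m : ℕ} (E : Adjacency n) (E' : Adjacency m)
               (owner : Fin m → Fin n) (orig : Fin n → Fin m) →
               IsTree E → IsTernarization E E' owner orig →
               ∀ (u v r : Fin n) (c' : Fin m) →
               IsLCA E' (orig u) (orig v) (orig r) c' →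
               IsLCA E u v r (owner c')
theorem4p7 E E′ owner orig T T′ u v r c′ lca@((c′u , c′v) , _) =
  ( ancestor-owner c′u (owner-orig u) (owner-orig r)
  , ancestor-owner c′v (owner-orig v) (owner-orig r) ) ,
  λ _ → owner-lca-lowest lca
  where
  open Ternarization T T′
  open IsTernarization T′ using (owner-orig)
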